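{- Let $(Y,\sim)$ be an arbitrary object of ${\sf RT}(\mathcal S)$ and let $(X,E)$ be an assembly over $\mathcal S$. Then the exponential $(Y,\sim)^{(X,E)}$ in ${\sf RT}(\mathcal S)$ is isomorphic to the object $(F,\approx)$ defined as follows. The underlying set $F$ is the set of all functions $f\colon\{(x,U)\mid x\in X,\ U\in E(x)\}\to Y$. For $f,g\in F$, the set $[f\approx g]$ consists of those coded triples $[P,Q,R]$ of elements of $\mathcal S$ satisfying: (1) for all $x\in X$ and $U\in E(x)$: $PU\in[f(x,U)\sim f(x,U)]$; (2) for all $x\in X$ and $U,U'\in E(x)$: $QUU'\in[f(x,U)\sim f(x,U')]$; (3) for all $x\in X$ and $U\in E(x)$: $RU\in[f(x,U)\sim g(x,U)]$.
   Context: $\mathcal S$ denotes Scott's graph model: the set $\mathcal P(\mathbb N)$ with application $UV=\{n\mid \text{for some } m,\ e_m\subseteq V\text{ and }\langle m,n\rangle\in U\}$, where $e_m=\{k_1,\dots,k_r\}$ iff $m=2^{k_1}+\dots+2^{k_r}$ (and $e_0=\emptyset$) and $\langle\cdot,\cdot\rangle$ is a fixed bijection $\mathbb N\times\mathbb N\to\mathbb N$; this is a combinatory algebra (a $\lambda$-model). Iterated application associates to the left. $[U_0,\dots,U_n]$ denotes a standard coding of finite tuples of elements of $\mathcal S$ inside $\mathcal S$ (with combinators computing length, components, and concatenation). An assembly over $\mathcal S$ is a pair $(X,E)$ with $X$ a set and $E(x)$ a nonempty subset of $\mathcal S$ for each $x\in X$. ${\sf RT}(\mathcal S)$ is the realizability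 topos over $\mathcal S$; its objects are pairs $(Y,\sim)$ with $Y$ a set and $[y\sim y']\subseteq\mathcal S$ a $\mathcal P(\mathcal S)$-valued partial equivalence relation (in the realizability sense); an assembly $(X,E)$ is regarded as the object with $[x\sim x]=E(x)$ and $[x\sim x']=\emptyset$ for $x\neq x'$. -}

module Defs where

open import Level using (Level; _⊔_; Lift; lift) renaming (suc to lsuc; zero to lzero)
open import Data.Nat using (ℕ; zero; suc; _*_; _%_; _/_; _≡ᵇ_)
open import Data.Bool using (Bool; T)
open import Data.Product using (Σ; _×_; _,_; proj₁; proj₂; Σ-syntax)
open import Data.Sum using (_⊎_; inj₁; inj₂)
open import Data.Empty using (⊥)
open import Data.List using (List; []; _∷_; length)
open import Relation.Binary.PropositionalEquality using (_≡_; subst)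
open import Function using (_$_)

-- Scott's graph model S = P(ℕ).  A subset of ℕ is a predicate ℕ → Set;
-- two such predicates denote the same element when extensionally equal.

𝕊 : Set₁
𝕊 = ℕ → Set

_≐_ : 𝕊 → 𝕊 → Set
U ≐ V = ∀ n → (U n → V n) × (V n → U n)

≐-sym : ∀ {U V} → U ≐ V → V ≐ U
≐-sym p n = proj₂ (p n) , proj₁ (p n)

≐-trans : ∀ {U V W} → U ≐ V → V ≐ W → U ≐ W
≐-trans p q n = (λ u → proj₁ (q n) (proj₁ (p n) u)) , (λ w → proj₂ (p n) (proj₂ (q n) w))

bit : ℕ → ℕ → Bool
bit m zero    = m % 2 ≡ᵇ 1
bit m (suc k) = bit (m / 2) k

-- e_m ⊆ V, where e_m = { k | bit k of m is 1 }  (so m = Σ_{k ∈ e_m} 2^k)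
_e⊆_ : ℕ → 𝕊 → Set
m e⊆ V = ∀ k → T (bit m k) → V k

_⊕_ : 𝕊 → 𝕊 → 𝕊
(U ⊕ V) n = (Σ[ k ∈ ℕ ] (n ≡ 2 * k × U k)) ⊎ (Σ[ k ∈ ℕ ] (n ≡ suc (2 * k) × V k))

π₁ : 𝕊 → 𝕊
π₁ W k = W (2 * k)

π₂ : 𝕊 → 𝕊
π₂ W k = W (suc (2 * k))

num : ℕ → 𝕊
num n k = k ≡ n

∅ₛ : 𝕊
∅ₛ _ = ⊥

-- Coding of finite tuples [U₀,…,Uₙ] : pair of the length with a nested
-- right-associated pairing of the components.
nest : List 𝕊 → 𝕊
nest []       = ∅ₛ
nest (U ∷ us) = U ⊕ nest us

⌜_⌝ : List 𝕊 → 𝕊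
⌜ us ⌝ = num (length us) ⊕ nest us

triple : 𝕊 → 𝕊 → 𝕊 → 𝕊
triple P Q R = ⌜ P ∷ Q ∷ R ∷ [] ⌝

-- Subsets of S (elements of P(S)): predicates on S invariant under
-- extensional equality of elements of S.

record PS (ℓ : Level) : Set (lsuc ℓ) where
  constructor mkPS
  field
    mem  : 𝕊 → Set ℓ
    resp : ∀ {U V} → U ≐ V → mem U → mem V

infix 4 _∈_
_∈_ : ∀ {ℓ} → 𝕊 → PS ℓ → Set ℓ
U ∈ A = PS.mem A U

-- Objects (Y, ∼) with P(S)-valued relation (the realizability PER
-- conditions are imposed separately by IsObject, inside Model).
record PreObj (c ℓ : Level) : Set (lsuc (c ⊔ ℓ)) where
  constructor mkObj
  field
    Car : Set c
    _∼_ : Car → Car → PS ℓ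

infixr 6 _∧_
_∧_ : ∀ {i j} → PS i → PS j → PS (i ⊔ j)
A ∧ B = mkPS (λ W → π₁ W ∈ A × π₂ W ∈ B)
             (λ p (a , b) → PS.resp A (λ k → p (2 * k)) a , PS.resp B (λ k → p (suc (2 * k))) b)

⋀ : ∀ {i ℓ} (I : Set i) → (I → PS ℓ) → PS (i ⊔ ℓ)
⋀ I A = mkPS (λ U → ∀ x → U ∈ A x) (λ p h x → PS.resp (A x) p (h x))

⋁ : ∀ {i ℓ} (I : Set i) → (I → PS ℓ) → PS (i ⊔ ℓ)
⋁ I A = mkPS (λ U → Σ[ x ∈ I ] (U ∈ A x)) (λ p (x , h) → x , PS.resp (A x) p h)

↑ : ∀ {i} j → PS i → PS (i ⊔ j)
↑ j A = mkPS (λ U → Lift j (U ∈ A)) (λ p (lift u) → lift (PS.resp A p u))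

module Model (⟨_,_⟩ : ℕ → ℕ → ℕ) where

  infixl 9 _·_
  _·_ : 𝕊 → 𝕊 → 𝕊
  (U · V) n = Σ[ m ∈ ℕ ] (m e⊆ V × U ⟨ m , n ⟩)

  ·-respˡ : ∀ {a a' U} → a ≐ a' → (a · U) ≐ (a' · U)
  ·-respˡ {a} {a'} {U} p n =
    (λ (m , s , h) → m , s , proj₁ (p ⟨ m , n ⟩) h) ,
    (λ (m , s , h) → m , s , proj₂ (p ⟨ m , n ⟩) h)

  infixr 5 _⇒_
  _⇒_ : ∀ {i j} → PS i → PS j → PS (lsuc lzero ⊔ i ⊔ j)
  A ⇒ B = mkPS (λ a → ∀ U → U ∈ A → a · U ∈ B)
               (λ p h U u → PS.resp B (·-respˡ p) (h U u))

  ⊩_ : ∀ {ℓ} → PS ℓ → Set (lsuc lzero ⊔ ℓ)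
  ⊩ A = Σ[ a ∈ 𝕊 ] (a ∈ A)

  module _ {c ℓ : Level} (A : PreObj c ℓ) where
    open PreObj A

    IsObject : Set (lsuc lzero ⊔ c ⊔ ℓ)
    IsObject = (⊩ ⋀ Car λ y → ⋀ Car λ y' → (y ∼ y') ⇒ (y' ∼ y))
             × (⊩ ⋀ Car λ y → ⋀ Car λ y' → ⋀ Car λ y'' → ((y ∼ y') ∧ (y' ∼ y'')) ⇒ (y ∼ y''))

  module _ {c₁ ℓ₁ c₂ ℓ₂ r : Level} (A : PreObj c₁ ℓ₁) (B : PreObj c₂ ℓ₂) where
    private
      module A = PreObj A
      module B = PreObj B

    L : Level
    L = lsuc lzero ⊔ c₁ ⊔ ℓ₁ ⊔ c₂ ⊔ ℓ₂ ⊔ r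

    Strict Relational SingleValued Total FunRel : (A.Car → B.Car → PS r) → PS L
    Strict G = ↑ L $ ⋀ A.Car λ x → ⋀ B.Car λ y → G x y ⇒ ((x A.∼ x) ∧ (y B.∼ y))
    Relational G = ↑ L $ ⋀ A.Car λ x → ⋀ A.Car λ x' → ⋀ B.Car λ y → ⋀ B.Car λ y' →
      ((x A.∼ x') ∧ G x y ∧ (y B.∼ y')) ⇒ G x' y'
    SingleValued G = ↑ L $ ⋀ A.Car λ x → ⋀ B.Car λ y → ⋀ B.Car λ y' →
      (G x y ∧ G x y') ⇒ (y B.∼ y')
    Total G = ↑ L $ ⋀ A.Car λ x → (x A.∼ x) ⇒ ⋁ B.Car λ y → G x y
    FunRel G = Strict G ∧ Relational G ∧ SingleValued G ∧ Total G

    IsFunRel : (A.Car → B.Car → PS r) → Set (lsuc lzero ⊔ c₁ ⊔ ℓ₁ ⊔ c₂ ⊔ ℓ₂ ⊔ r)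
    IsFunRel G = ⊩ FunRel G

    -- The exponential B^A of RT(S) (standard construction), with P(S) taken
    -- at level r: carrier P(S)^(A×B), [F ≈ F'] = E(F) ∧ E(F') ∧ ∀x∀y (F ↔ F').
    Exp : PreObj (lsuc r ⊔ c₁ ⊔ c₂) (lsuc lzero ⊔ c₁ ⊔ ℓ₁ ⊔ c₂ ⊔ ℓ₂ ⊔ r)
    Exp = mkObj (A.Car → B.Car → PS r)
                (λ F F' → (FunRel F ∧ FunRel F') ∧
                          (⋀ A.Car λ x → ⋀ B.Car λ y → (F x y ⇒ F' x y) ∧ (F' x y ⇒ F x y)))

  SameRel : ∀ {a b i j} {I : Set a} {J : Set b} → (I → J → PS i) → (I → J → PS j) →
            Set (lsuc lzero ⊔ a ⊔ b ⊔ i ⊔ j)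
  SameRel {I = I} {J} G G' = ⊩ ⋀ I λ x → ⋀ J λ y → (G x y ⇒ G' x y) ∧ (G' x y ⇒ G x y)

  _∘R_ : ∀ {a b d i j} {I : Set a} {J : Set b} {K : Set d} →
         (J → K → PS j) → (I → J → PS i) → I → K → PS (b ⊔ i ⊔ j)
  _∘R_ {J = J} H G x z = ⋁ J λ y → G x y ∧ H y z

  -- Isomorphism in RT(S): morphisms G : A → B, H : B → A (functional
  -- relations) with H∘G = id_A and G∘H = id_B (identity = the relation ∼).
  Iso : ∀ {c₁ ℓ₁ c₂ ℓ₂} → PreObj c₁ ℓ₁ → PreObj c₂ ℓ₂ → Set (lsuc (lsuc lzero ⊔ c₁ ⊔ ℓ₁ ⊔ c₂ ⊔ ℓ₂))
  Iso {c₁} {ℓ₁} {c₂} {ℓ₂} A B =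
    Σ[ G ∈ (PreObj.Car A → PreObj.Car B → PS r) ]
    Σ[ H ∈ (PreObj.Car B → PreObj.Car A → PS r) ]
      IsFunRel A B G × IsFunRel B A H
      × SameRel (H ∘R G) (PreObj._∼_ A) × SameRel (G ∘R H) (PreObj._∼_ B)
    where r = lsuc lzero ⊔ c₁ ⊔ ℓ₁ ⊔ c₂ ⊔ ℓ₂

  IsAssembly : ∀ {a e} (X : Set a) → (X → PS e) → Set (lsuc lzero ⊔ a ⊔ e)
  IsAssembly X E = ∀ x → Σ[ U ∈ 𝕊 ] (U ∈ E x)

  Asm : ∀ {a e} (X : Set a) → (X → PS e) → PreObj a (a ⊔ e)
  Asm X E = mkObj X (λ x x' → mkPS (λ U → (x ≡ x') × U ∈ E x)
                                   (λ p (q , u) → q , PS.resp (E x) p u))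

  module _ {c ℓ a e} (Y : PreObj c ℓ) (X : Set a) (E : X → PS e) where
    open PreObj Y

    Dom : Set (lsuc lzero ⊔ a ⊔ e)
    Dom = Σ[ x ∈ X ] Σ[ U ∈ 𝕊 ] (U ∈ E x)

    F : Set (lsuc lzero ⊔ a ⊔ e ⊔ c)
    F = Dom → Car

    ≈-cond : F → F → 𝕊 → 𝕊 → 𝕊 → Set (lsuc lzero ⊔ a ⊔ e ⊔ ℓ)
    ≈-cond f g P Q R =
        (∀ x U (u : U ∈ E x) → P · U ∈ (f (x , U , u) ∼ f (x , U , u)))
      × (∀ x U U' (u : U ∈ E x) (u' : U' ∈ E x) → Q · U · U' ∈ (f (x , U , u) ∼ f (x , U' , u')))
      × (∀ x U (u : U ∈ E x) → R · U ∈ (f (x , U , u) ∼ g (x , U , u)))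

    _≈_ : F → F → PS (lsuc lzero ⊔ a ⊔ e ⊔ ℓ)
    f ≈ g = mkPS (λ W → Σ[ P ∈ 𝕊 ] Σ[ Q ∈ 𝕊 ] Σ[ R ∈ 𝕊 ] (W ≐ triple P Q R × ≈-cond f g P Q R))
                 (λ p (P , Q , R , w , h) → P , Q , R , ≐-trans (≐-sym p) w , h)

    Fobj : PreObj (lsuc lzero ⊔ a ⊔ e ⊔ c) (lsuc lzero ⊔ a ⊔ e ⊔ ℓ)
    Fobj = mkObj F _≈_

{-# OPTIONS --safe #-}
module Submission where

-- An element of the exponential is, up to ≃, a functional relation R from (X, E) to (Y, ∼).
-- Since [x ∼ x] = E(x), totality of R turns each U ∈ E(x) into a value f(x, U) together with a
-- realizer of R(x, f(x, U)) computed uniformly from U.  The relation "f is a choice function of R"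
-- is a functional relation from the exponential to (F, ≈).  It is injective, because two functional
-- relations sharing a choice function contain each other (by strictness, single-valuedness and
-- relationality), and surjective, because f is a choice function of the functional relation
-- {⟨U₀, H⟩ | U₀ ∈ E(x), ∀ U ∈ E(x). H U ∈ [f(x, U) ∼ y]}.  A bijective functional relation is an
-- isomorphism whose inverse is its converse.
-- The realizers are written as λ-terms over 𝕊.  β-conversion holds for them in the graph model
-- because the value of a term only depends on finite parts of its environment.

open import Defs
open import Level using (Level; _⊔_; lift; lower) renaming (suc to lsuc; zero to lzero)
open import Data.Bool using (Bool; true; false; T; T?; if_then_else_) renaming (_∧_ to _&&_)
open import Data.Bool.Properties using (T-∧)
open import Data.Nat using (ℕ; zero; suc; _+_; _*_; _/_; _<_; _<ᵇ_; _≡ᵇ_; s≤s; z≤n)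
open import Data.Nat.Properties using (<⇒<ᵇ; ≤-trans; *-cancelˡ-≡; suc-injective; even≢odd)
open import Data.Nat.DivMod using ([m+kn]%n≡m%n; +-distrib-/-∣ʳ; m*n/n≡m; m/n<m)
open import Data.Nat.Divisibility using (n∣m*n)
open import Data.Fin using (Fin; zero; suc; _≟_)
open import Data.List using (List; []; _∷_; [_]; _++_; upTo; filter)
open import Data.List.Extrema.Nat using (max; xs≤max)
open import Data.List.Membership.Propositional renaming (_∈_ to _∈ₗ_)
open import Data.List.Membership.Propositional.Properties
  using (∈-++⁺ˡ; ∈-++⁺ʳ; ∈-++⁻; ∈-upTo⁺; ∈-filter⁺; ∈-filter⁻)
open import Data.List.Membership.DecPropositional Data.Nat._≟_ using (_∈?_)
import Data.List.Relation.Unary.All as All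
open import Data.List.Relation.Unary.Any using (here; there)
open import Data.Vec.Functional using (Vector; tail; updateAt) renaming ([] to ε; _∷_ to _∷ₑ_)
open import Data.Vec.Functional.Properties using (updateAt-updates; updateAt-minimal)
open import Data.Product using (Σ-syntax; _×_; _,_; proj₁; proj₂)
import Data.Sum as ⊎
open import Data.Sum using (inj₁; inj₂)
open import Data.Empty using (⊥-elim)
open import Function using (_∘_; flip)
open import Function.Bundles using (_⤖_; Bijection; Equivalence)
open import Relation.Nullary using (yes; no; contradiction)
open import Relation.Nullary.Decidable using (isYes; toWitness; fromWitness)
open import Relation.Binary.PropositionalEquality using (_≡_; refl; sym; trans; subst; cong)

private variable
  n : ℕ
  U V W : 𝕊

-- Finite sets of natural numbers and their codes

infix 4 _⊆_

_⊆_ : 𝕊 → 𝕊 → Set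
U ⊆ V = ∀ k → U k → V k

⊆-refl : U ⊆ U
⊆-refl k u = u

decode : ℕ → 𝕊
decode m k = T (bit m k)

bit-0 : ∀ k → bit 0 k ≡ false
bit-0 zero    = refl
bit-0 (suc k) = bit-0 k

bit⇒< : ∀ m k → T (bit m k) → k < m
bit⇒< zero    k       b = ⊥-elim (subst T (bit-0 k) b)
bit⇒< (suc m) zero    b = s≤s z≤n
bit⇒< (suc m) (suc k) b = ≤-trans (s≤s (bit⇒< (suc m / 2) k b)) (m/n<m (suc m) 2 (s≤s (s≤s z≤n)))

digit : Bool → ℕ
digit x = if x then 1 else 0

bit-[digit+c*2]-0 : ∀ x c → bit (digit x + c * 2) 0 ≡ x
bit-[digit+c*2]-0 false c = cong (_≡ᵇ 1) ([m+kn]%n≡m%n 0 c 2)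
bit-[digit+c*2]-0 true  c = cong (_≡ᵇ 1) ([m+kn]%n≡m%n 1 c 2)

[digit+c*2]/2≡c : ∀ x c → (digit x + c * 2) / 2 ≡ c
[digit+c*2]/2≡c false c = m*n/n≡m c 2
[digit+c*2]/2≡c true  c = trans (+-distrib-/-∣ʳ 1 {d = 2} (n∣m*n c)) (m*n/n≡m c 2)

fromBits : ℕ → (ℕ → Bool) → ℕ
fromBits zero    p = 0
fromBits (suc b) p = digit (p 0) + fromBits b (p ∘ suc) * 2

bit-fromBits : ∀ b p k → bit (fromBits b p) k ≡ (k <ᵇ b) && p k
bit-fromBits zero    p k       = bit-0 k
bit-fromBits (suc b) p zero    = bit-[digit+c*2]-0 (p 0) (fromBits b (p ∘ suc))
bit-fromBits (suc b) p (suc k) =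
  trans (cong (λ m → bit m k) ([digit+c*2]/2≡c (p 0) _)) (bit-fromBits b (p ∘ suc) k)

⌊_⌋ : List ℕ → ℕ
⌊ xs ⌋ = fromBits (suc (max 0 xs)) (λ k → isYes (k ∈? xs))

bit-⌊⌋ : ∀ k xs → bit ⌊ xs ⌋ k ≡ (k <ᵇ suc (max 0 xs)) && isYes (k ∈? xs)
bit-⌊⌋ k xs = bit-fromBits (suc (max 0 xs)) (λ j → isYes (j ∈? xs)) k

∈⇒bit-⌊⌋ : ∀ {k xs} → k ∈ₗ xs → T (bit ⌊ xs ⌋ k)
∈⇒bit-⌊⌋ {k} {xs} k∈xs = subst T (sym (bit-⌊⌋ k xs))
  (Equivalence.from T-∧ (<⇒<ᵇ (s≤s (All.lookup (xs≤max 0 xs) k∈xs)) , fromWitness {a? = k ∈? xs} k∈xs))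

bit-⌊⌋⇒∈ : ∀ {k xs} → T (bit ⌊ xs ⌋ k) → k ∈ₗ xs
bit-⌊⌋⇒∈ {k} {xs} b = toWitness {a? = k ∈? xs} (proj₂ (Equivalence.to T-∧ (subst T (bit-⌊⌋ k xs) b)))

bits : ℕ → List ℕ
bits m = filter (λ j → T? (bit m j)) (upTo m)

bit⇒∈bits : ∀ {m j} → T (bit m j) → j ∈ₗ bits m
bit⇒∈bits {m} {j} b = ∈-filter⁺ (λ j → T? (bit m j)) (∈-upTo⁺ (bit⇒< m j b)) b

∈bits⇒bit : ∀ {m j} → j ∈ₗ bits m → T (bit m j)
∈bits⇒bit {m} j∈ = proj₂ (∈-filter⁻ (λ j → T? (bit m j)) {xs = upTo m} j∈)

≐-refl : U ≐ U
≐-refl k = (λ u → u) , (λ u → u)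

π₁-cong : U ≐ V → π₁ U ≐ π₁ V
π₁-cong p k = p (2 * k)

π₂-cong : U ≐ V → π₂ U ≐ π₂ V
π₂-cong p k = p (suc (2 * k))

π₁-⊕ : ∀ U V → π₁ (U ⊕ V) ≐ U
π₁-⊕ U V k = π₁⊆ , λ u → inj₁ (k , refl , u)
  where
  π₁⊆ : π₁ (U ⊕ V) k → U k
  π₁⊆ (inj₁ (j , eq , u)) = subst U (sym (*-cancelˡ-≡ k j 2 eq)) u
  π₁⊆ (inj₂ (j , eq , _)) = contradiction eq (even≢odd k j)

π₂-⊕ : ∀ U V → π₂ (U ⊕ V) ≐ V
π₂-⊕ U V k = π₂⊆ , λ v → inj₂ (k , refl , v)
  where
  π₂⊆ : π₂ (U ⊕ V) k → V k
  π₂⊆ (inj₁ (j , eq , _)) = contradiction (sym eq) (even≢odd j k)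
  π₂⊆ (inj₂ (j , eq , v)) = subst V (sym (*-cancelˡ-≡ k j 2 (suc-injective eq))) v

∧-intro : ∀ {i j} (A : PS i) (B : PS j) → U ∈ A → V ∈ B → U ⊕ V ∈ A ∧ B
∧-intro {U} {V} A B u v = PS.resp A (≐-sym (π₁-⊕ U V)) u , PS.resp B (≐-sym (π₂-⊕ U V)) v

∧₃-intro : ∀ {i j l} (A : PS i) (B : PS j) (C : PS l) → U ∈ A → V ∈ B → W ∈ C → U ⊕ (V ⊕ W) ∈ A ∧ B ∧ C
∧₃-intro A B C u v w = ∧-intro A (B ∧ C) u (∧-intro B C v w)

Pᵣ Qᵣ Rᵣ : 𝕊 → 𝕊
Pᵣ = π₁ ∘ π₂
Qᵣ = π₁ ∘ π₂ ∘ π₂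
Rᵣ = π₁ ∘ π₂ ∘ π₂ ∘ π₂

private
  head-≐ : W ≐ (U ⊕ V) → π₁ W ≐ U
  head-≐ w = ≐-trans (π₁-cong w) (π₁-⊕ _ _)

  tail-≐ : W ≐ (U ⊕ V) → π₂ W ≐ V
  tail-≐ w = ≐-trans (π₂-cong w) (π₂-⊕ _ _)

Pᵣ-triple : ∀ {P Q R} → W ≐ triple P Q R → Pᵣ W ≐ P
Pᵣ-triple w = head-≐ (tail-≐ w)

Qᵣ-triple : ∀ {P Q R} → W ≐ triple P Q R → Qᵣ W ≐ Q
Qᵣ-triple w = head-≐ (tail-≐ (tail-≐ w))

Rᵣ-triple : ∀ {P Q R} → W ≐ triple P Q R → Rᵣ W ≐ R
Rᵣ-triple w = head-≐ (tail-≐ (tail-≐ (tail-≐ w)))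

module _ (⟨_,_⟩ : ℕ → ℕ → ℕ)
         (⟨⟩-injective : ∀ {m k m′ k′} → ⟨ m , k ⟩ ≡ ⟨ m′ , k′ ⟩ → m ≡ m′ × k ≡ k′) where

  open Model ⟨_,_⟩

  -- λ-terms over 𝕊

  Env : ℕ → Set₁
  Env = Vector 𝕊

  infix 4 _⊆ₑ_

  _⊆ₑ_ : Env n → Env n → Set
  ρ ⊆ₑ ρ′ = ∀ i → ρ i ⊆ ρ′ i

  ∷-mono-⊆ₑ : {ρ ρ′ : Env n} → U ⊆ V → ρ ⊆ₑ ρ′ → (U ∷ₑ ρ) ⊆ₑ (V ∷ₑ ρ′)
  ∷-mono-⊆ₑ U⊆V ρ⊆ρ′ zero    = U⊆V
  ∷-mono-⊆ₑ U⊆V ρ⊆ρ′ (suc i) = ρ⊆ρ′ i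

  infixl 9 _∙_
  infixr 7 _⊗_
  infix  6 ƛ_

  -- Names ending in ᵗ are realizer terms or operations on them; names ending in ᵣ are their counterparts in 𝕊.
  data Term (n : ℕ) : Set₁ where
    var     : Fin n → Term n
    cst     : 𝕊 → Term n
    _∙_ _⊗_ : Term n → Term n → Term n
    fst snd : Term n → Term n
    ƛ_      : Term (suc n) → Term n

  v₀ : Term (suc n)
  v₀ = var zero

  v₁ : Term (suc (suc n))
  v₁ = var (suc zero)

  v₂ : Term (suc (suc (suc n)))
  v₂ = var (suc (suc zero))

  ⟦_⟧ : Term n → Env n → 𝕊
  ⟦ var i ⟧ ρ = ρ i
  ⟦ cst U ⟧ ρ = U
  ⟦ t ∙ u ⟧ ρ = ⟦ t ⟧ ρ · ⟦ u ⟧ ρ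
  ⟦ t ⊗ u ⟧ ρ = ⟦ t ⟧ ρ ⊕ ⟦ u ⟧ ρ
  ⟦ fst t ⟧ ρ = π₁ (⟦ t ⟧ ρ)
  ⟦ snd t ⟧ ρ = π₂ (⟦ t ⟧ ρ)
  ⟦ ƛ t ⟧ ρ n = Σ[ m ∈ ℕ ] Σ[ k ∈ ℕ ] (n ≡ ⟨ m , k ⟩ × ⟦ t ⟧ (decode m ∷ₑ ρ) k)

  ⟦⟧-mono : (t : Term n) {ρ ρ′ : Env n} → ρ ⊆ₑ ρ′ → ⟦ t ⟧ ρ ⊆ ⟦ t ⟧ ρ′
  ⟦⟧-mono (var i) ρ⊆ρ′ = ρ⊆ρ′ i
  ⟦⟧-mono (cst U) ρ⊆ρ′ = ⊆-refl
  ⟦⟧-mono (t ∙ u) ρ⊆ρ′ k (m , m⊆ , h) = m , (λ j b → ⟦⟧-mono u ρ⊆ρ′ j (m⊆ j b)) , ⟦⟧-mono t ρ⊆ρ′ _ h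
  ⟦⟧-mono (t ⊗ u) ρ⊆ρ′ k (inj₁ (j , eq , h)) = inj₁ (j , eq , ⟦⟧-mono t ρ⊆ρ′ j h)
  ⟦⟧-mono (t ⊗ u) ρ⊆ρ′ k (inj₂ (j , eq , h)) = inj₂ (j , eq , ⟦⟧-mono u ρ⊆ρ′ j h)
  ⟦⟧-mono (fst t) ρ⊆ρ′ k = ⟦⟧-mono t ρ⊆ρ′ _
  ⟦⟧-mono (snd t) ρ⊆ρ′ k = ⟦⟧-mono t ρ⊆ρ′ _
  ⟦⟧-mono (ƛ t)   ρ⊆ρ′ k (m , j , eq , h) = m , j , eq , ⟦⟧-mono t (∷-mono-⊆ₑ ⊆-refl ρ⊆ρ′) j h

  Approx : ℕ → Set
  Approx = Vector (List ℕ)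

  ⟪_⟫ : Approx n → Env n
  ⟪ as ⟫ i k = k ∈ₗ as i

  ∅ₐ : Approx n
  ∅ₐ _ = []

  _∪ₐ_ : Approx n → Approx n → Approx n
  (as ∪ₐ bs) i = as i ++ bs i

  ⟪∅ₐ⟫⊆ₑ : {ρ : Env n} → ⟪ ∅ₐ ⟫ ⊆ₑ ρ
  ⟪∅ₐ⟫⊆ₑ i k ()

  ⟪⟫⊆ₑ⟪∪ₐ⟫ˡ : (as bs : Approx n) → ⟪ as ⟫ ⊆ₑ ⟪ as ∪ₐ bs ⟫
  ⟪⟫⊆ₑ⟪∪ₐ⟫ˡ as bs i k = ∈-++⁺ˡ

  ⟪⟫⊆ₑ⟪∪ₐ⟫ʳ : (as bs : Approx n) → ⟪ bs ⟫ ⊆ₑ ⟪ as ∪ₐ bs ⟫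
  ⟪⟫⊆ₑ⟪∪ₐ⟫ʳ as bs i k = ∈-++⁺ʳ (as i)

  ⟪∪ₐ⟫-lub : {as bs : Approx n} {ρ : Env n} → ⟪ as ⟫ ⊆ₑ ρ → ⟪ bs ⟫ ⊆ₑ ρ → ⟪ as ∪ₐ bs ⟫ ⊆ₑ ρ
  ⟪∪ₐ⟫-lub {as = as} as⊆ bs⊆ i k k∈ = ⊎.[ as⊆ i k , bs⊆ i k ] (∈-++⁻ (as i) k∈)

  point : Fin n → ℕ → Approx n
  point i k = updateAt ∅ₐ i (λ _ → [ k ])

  ∈-point : ∀ (i : Fin n) k → ⟪ point i k ⟫ i k
  ∈-point i k = subst (k ∈ₗ_) (sym (updateAt-updates i ∅ₐ)) (here refl)

  ⟪point⟫⊆ₑ : ∀ {ρ : Env n} i k → ρ i k → ⟪ point i k ⟫ ⊆ₑ ρ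
  ⟪point⟫⊆ₑ i k h j l l∈ with j ≟ i
  ... | yes refl with here refl ← subst (l ∈ₗ_) (updateAt-updates i ∅ₐ) l∈ = h
  ... | no j≢i   with () ← subst (l ∈ₗ_) (updateAt-minimal j i ∅ₐ j≢i) l∈

  FinitelySupported : (Env n → 𝕊) → Env n → ℕ → Set
  FinitelySupported S ρ k = Σ[ as ∈ Approx _ ] (⟪ as ⟫ ⊆ₑ ρ × S ⟪ as ⟫ k)

  joinSupports : (S : Env n → 𝕊) → (∀ {ρ ρ′} → ρ ⊆ₑ ρ′ → S ρ ⊆ S ρ′) → {ρ : Env n} (js : List ℕ) →
    (∀ {j} → j ∈ₗ js → FinitelySupported S ρ j) →
    Σ[ as ∈ Approx n ] (⟪ as ⟫ ⊆ₑ ρ × ∀ {j} → j ∈ₗ js → S ⟪ as ⟫ j)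
  joinSupports S S-mono []       _   = ∅ₐ , ⟪∅ₐ⟫⊆ₑ , λ ()
  joinSupports S S-mono (j ∷ js) sup
    with as , as⊆ , s  ← sup (here refl)
       | bs , bs⊆ , ss ← joinSupports S S-mono js (sup ∘ there)
    = as ∪ₐ bs , ⟪∪ₐ⟫-lub as⊆ bs⊆ , λ where
        (here refl) → S-mono (⟪⟫⊆ₑ⟪∪ₐ⟫ˡ as bs) _ s
        (there j∈)  → S-mono (⟪⟫⊆ₑ⟪∪ₐ⟫ʳ as bs) _ (ss j∈)

  ⟦⟧-finitary : (t : Term n) {ρ : Env n} → ∀ k → ⟦ t ⟧ ρ k → FinitelySupported ⟦ t ⟧ ρ k
  ⟦⟧-finitary (var i) k h = point i k , ⟪point⟫⊆ₑ i k h , ∈-point i k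
  ⟦⟧-finitary (cst U) k h = ∅ₐ , ⟪∅ₐ⟫⊆ₑ , h
  ⟦⟧-finitary (t ∙ u) k (m , m⊆ , h)
    with as , as⊆ , ht ← ⟦⟧-finitary t _ h
       | bs , bs⊆ , hu ← joinSupports ⟦ u ⟧ (⟦⟧-mono u) (bits m) (λ j∈ → ⟦⟧-finitary u _ (m⊆ _ (∈bits⇒bit j∈)))
    = as ∪ₐ bs , ⟪∪ₐ⟫-lub as⊆ bs⊆ ,
      m , (λ j b → ⟦⟧-mono u (⟪⟫⊆ₑ⟪∪ₐ⟫ʳ as bs) j (hu (bit⇒∈bits b))) , ⟦⟧-mono t (⟪⟫⊆ₑ⟪∪ₐ⟫ˡ as bs) _ ht
  ⟦⟧-finitary (t ⊗ u) k (inj₁ (j , eq , h)) with as , as⊆ , h′ ← ⟦⟧-finitary t j h = as , as⊆ , inj₁ (j , eq , h′)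
  ⟦⟧-finitary (t ⊗ u) k (inj₂ (j , eq , h)) with as , as⊆ , h′ ← ⟦⟧-finitary u j h = as , as⊆ , inj₂ (j , eq , h′)
  ⟦⟧-finitary (fst t) k h = ⟦⟧-finitary t _ h
  ⟦⟧-finitary (snd t) k h = ⟦⟧-finitary t _ h
  ⟦⟧-finitary (ƛ t) _ (m , k , eq , h) with as , as⊆ , h′ ← ⟦⟧-finitary t k h =
    tail as , as⊆ ∘ suc , m , k , eq , ⟦⟧-mono t (λ { zero → as⊆ zero ; (suc i) → ⊆-refl }) k h′

  β : (t : Term (suc n)) (ρ : Env n) (U : 𝕊) → (⟦ ƛ t ⟧ ρ · U) ≐ ⟦ t ⟧ (U ∷ₑ ρ)
  β t ρ U k = app⇒subst , subst⇒app
    where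
    app⇒subst : (⟦ ƛ t ⟧ ρ · U) k → ⟦ t ⟧ (U ∷ₑ ρ) k
    app⇒subst (m , m⊆U , _ , _ , eq , h) with refl , refl ← ⟨⟩-injective eq =
      ⟦⟧-mono t (∷-mono-⊆ₑ m⊆U (λ _ → ⊆-refl)) k h
    subst⇒app : ⟦ t ⟧ (U ∷ₑ ρ) k → (⟦ ƛ t ⟧ ρ · U) k
    subst⇒app h with as , as⊆ , h′ ← ⟦⟧-finitary t k h =
      ⌊ as zero ⌋ , (λ j b → as⊆ zero j (bit-⌊⌋⇒∈ b)) , ⌊ as zero ⌋ , k , refl ,
      ⟦⟧-mono t (λ { zero j → ∈⇒bit-⌊⌋ ; (suc i) → as⊆ (suc i) }) k h′

  β-∈ : ∀ {i} (B : PS i) (t : Term (suc n)) (ρ : Env n) → ⟦ t ⟧ (U ∷ₑ ρ) ∈ B → ⟦ ƛ t ⟧ ρ · U ∈ B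
  β-∈ B t ρ = PS.resp B (≐-sym (β t ρ _))

  β₂-∈ : ∀ {i} (B : PS i) (t : Term (suc (suc n))) (ρ : Env n) →
    ⟦ t ⟧ (V ∷ₑ U ∷ₑ ρ) ∈ B → ⟦ ƛ ƛ t ⟧ ρ · U · V ∈ B
  β₂-∈ B t ρ = PS.resp B (≐-sym (≐-trans (·-respˡ (β (ƛ t) ρ _)) (β t (_ ∷ₑ ρ) _)))

  lam : Term 1 → 𝕊
  lam t = ⟦ ƛ t ⟧ ε

  lam-⇒ : ∀ {i j} (A : PS i) (B : PS j) (t : Term 1) → (∀ W → W ∈ A → ⟦ t ⟧ (W ∷ₑ ε) ∈ B) → lam t ∈ (A ⇒ B)
  lam-⇒ A B t h W w = β-∈ B t ε (h W w)

  idᵣ : 𝕊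
  idᵣ = lam v₀

  idᵣ-⇒ : ∀ {i} (A : PS i) → idᵣ ∈ (A ⇒ A)
  idᵣ-⇒ A = lam-⇒ A A v₀ λ W w → w

  -- Functional relations

  RelEquiv : ∀ {a b i j} {I : Set a} {J : Set b} → (I → J → PS i) → (I → J → PS j) →
             PS (lsuc lzero ⊔ a ⊔ b ⊔ i ⊔ j)
  RelEquiv {I = I} {J} R R′ = ⋀ I λ x → ⋀ J λ y → (R x y ⇒ R′ x y) ∧ (R′ x y ⇒ R x y)

  relEquiv-intro : ∀ {a b i j} {I : Set a} {J : Set b} {R : I → J → PS i} {R′ : I → J → PS j} →
    (∀ x y → U ∈ (R x y ⇒ R′ x y)) → (∀ x y → V ∈ (R′ x y ⇒ R x y)) → U ⊕ V ∈ RelEquiv R R′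
  relEquiv-intro {R = R} {R′} u v x y = ∧-intro (R x y ⇒ R′ x y) (R′ x y ⇒ R x y) (u x y) (v x y)

  relEquiv-refl : ∀ {a b i} {I : Set a} {J : Set b} (R : I → J → PS i) → idᵣ ⊕ idᵣ ∈ RelEquiv R R
  relEquiv-refl R = relEquiv-intro {R = R} {R} (λ x y → idᵣ-⇒ (R x y)) (λ x y → idᵣ-⇒ (R x y))

  funRel-intro : ∀ {c₁ ℓ₁ c₂ ℓ₂ r} (A : PreObj c₁ ℓ₁) (B : PreObj c₂ ℓ₂)
    (G : PreObj.Car A → PreObj.Car B → PS r) {st rel sv tot : 𝕊} →
    st ∈ Strict A B G → rel ∈ Relational A B G → sv ∈ SingleValued A B G → tot ∈ Total A B G →
    st ⊕ (rel ⊕ (sv ⊕ tot)) ∈ FunRel A B G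
  funRel-intro A B G st rel sv tot =
    ∧-intro (Strict A B G) (Relational A B G ∧ SingleValued A B G ∧ Total A B G) st
      (∧₃-intro (Relational A B G) (SingleValued A B G) (Total A B G) rel sv tot)

  strictᵗ relationalᵗ singleValuedᵗ totalᵗ : Term n → Term n
  strictᵗ       = fst
  relationalᵗ   = fst ∘ snd
  singleValuedᵗ = fst ∘ snd ∘ snd
  totalᵗ        = snd ∘ snd ∘ snd

  module FunRelRealizer {c₁ ℓ₁ c₂ ℓ₂ r} (A : PreObj c₁ ℓ₁) (B : PreObj c₂ ℓ₂)
                        (G : PreObj.Car A → PreObj.Car B → PS r) (V : 𝕊) (v : V ∈ FunRel A B G) where
    private
      module A = PreObj A
      module B = PreObj B

    strictᵣ relationalᵣ singleValuedᵣ totalᵣ : 𝕊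
    strictᵣ       = ⟦ strictᵗ (cst V) ⟧ ε
    relationalᵣ   = ⟦ relationalᵗ (cst V) ⟧ ε
    singleValuedᵣ = ⟦ singleValuedᵗ (cst V) ⟧ ε
    totalᵣ        = ⟦ totalᵗ (cst V) ⟧ ε

    strict : ∀ x y W → W ∈ G x y → strictᵣ · W ∈ ((x A.∼ x) ∧ (y B.∼ y))
    strict = lower (proj₁ v)

    relational : ∀ x x′ y y′ W → W ∈ ((x A.∼ x′) ∧ G x y ∧ (y B.∼ y′)) → relationalᵣ · W ∈ G x′ y′
    relational = lower (proj₁ (proj₂ v))

    singleValued : ∀ x y y′ W → W ∈ (G x y ∧ G x y′) → singleValuedᵣ · W ∈ (y B.∼ y′)
    singleValued = lower (proj₁ (proj₂ (proj₂ v)))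

    total : ∀ x W → W ∈ (x A.∼ x) → totalᵣ · W ∈ (⋁ B.Car λ y → G x y)
    total = lower (proj₂ (proj₂ (proj₂ v)))

  LeftStrict : ∀ {c ℓ} → PreObj c ℓ → PS (lsuc lzero ⊔ c ⊔ ℓ)
  LeftStrict A = ⋀ Car λ a → ⋀ Car λ a′ → (a ∼ a′) ⇒ (a ∼ a)
    where open PreObj A

  module _ {c₁ ℓ₁ c₂ ℓ₂} {A : PreObj c₁ ℓ₁} {B : PreObj c₂ ℓ₂}
           {G : PreObj.Car A → PreObj.Car B → PS (lsuc lzero ⊔ c₁ ⊔ ℓ₁ ⊔ c₂ ⊔ ℓ₂)}
           (G-funRel : IsFunRel A B G)
           (G-injective : ⊩ SingleValued B A (flip G)) (G-surjective : ⊩ Total B A (flip G)) where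
    private
      module A = PreObj A
      module B = PreObj B

      injᵣ surjᵣ : 𝕊
      injᵣ  = proj₁ G-injective
      surjᵣ = proj₁ G-surjective

      injective : ∀ b a a′ W → W ∈ (G a b ∧ G a′ b) → injᵣ · W ∈ (a A.∼ a′)
      injective = lower (proj₂ G-injective)

      surjective : ∀ b W → W ∈ (b B.∼ b) → surjᵣ · W ∈ (⋁ A.Car λ a → G a b)
      surjective = lower (proj₂ G-surjective)

    open FunRelRealizer A B G (proj₁ G-funRel) (proj₂ G-funRel)

    converse-isFunRel : IsFunRel B A (flip G)
    converse-isFunRel = lam swapᵗ ⊕ (lam reverseᵗ ⊕ (injᵣ ⊕ surjᵣ)) ,
      funRel-intro B A (flip G) (lift swap) (lift reverse) (proj₂ G-injective) (proj₂ G-surjective)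
      where
      swapᵗ reverseᵗ : Term 1
      swapᵗ    = snd (cst strictᵣ ∙ v₀) ⊗ fst (cst strictᵣ ∙ v₀)
      reverseᵗ = cst relationalᵣ ∙ (snd (snd v₀) ⊗ fst (snd v₀) ⊗ fst v₀)

      swap : ∀ y x → lam swapᵗ ∈ (G x y ⇒ ((y B.∼ y) ∧ (x A.∼ x)))
      swap y x = lam-⇒ (G x y) ((y B.∼ y) ∧ (x A.∼ x)) swapᵗ λ W w →
        ∧-intro (y B.∼ y) (x A.∼ x) (proj₂ (strict x y W w)) (proj₁ (strict x y W w))

      reverse : ∀ y y′ x x′ → lam reverseᵗ ∈ (((y B.∼ y′) ∧ G x y ∧ (x A.∼ x′)) ⇒ G x′ y′)
      reverse y y′ x x′ = lam-⇒ ((y B.∼ y′) ∧ G x y ∧ (x A.∼ x′)) (G x′ y′) reverseᵗ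
        λ W (y∼y′ , g , x∼x′) → relational x x′ y y′ _ (∧₃-intro (x A.∼ x′) (G x y) (y B.∼ y′) x∼x′ g y∼y′)

    converse-inverseˡ : ⊩ LeftStrict A → SameRel (flip G ∘R G) A._∼_
    converse-inverseˡ (lsᵣ , ls) = injᵣ ⊕ lam backᵗ ,
      relEquiv-intro {R = flip G ∘R G} {R′ = A._∼_} (λ a a′ W (b , w) → injective b a a′ W w) back
      where
      imageᵗ backᵗ : Term 1
      imageᵗ = cst totalᵣ ∙ (cst lsᵣ ∙ v₀)
      backᵗ  = imageᵗ ⊗ cst relationalᵣ ∙ (v₀ ⊗ imageᵗ ⊗ snd (cst strictᵣ ∙ imageᵗ))

      back : ∀ a a′ → lam backᵗ ∈ ((a A.∼ a′) ⇒ (flip G ∘R G) a a′)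
      back a a′ = lam-⇒ (a A.∼ a′) ((flip G ∘R G) a a′) backᵗ λ W w →
        let b , g = total a _ (ls a a′ W w)
        in b , ∧-intro (G a b) (G a′ b) g
                 (relational a a′ b b _ (∧₃-intro (a A.∼ a′) (G a b) (b B.∼ b) w g (proj₂ (strict a b _ g))))

    converse-inverseʳ : ⊩ LeftStrict B → SameRel (G ∘R flip G) B._∼_
    converse-inverseʳ (lsᵣ , ls) = singleValuedᵣ ⊕ lam backᵗ ,
      relEquiv-intro {R = G ∘R flip G} {R′ = B._∼_} (λ b b′ W (a , w) → singleValued a b b′ W w) back
      where
      preimageᵗ backᵗ : Term 1
      preimageᵗ = cst surjᵣ ∙ (cst lsᵣ ∙ v₀)
      backᵗ     = preimageᵗ ⊗ cst relationalᵣ ∙ (fst (cst strictᵣ ∙ preimageᵗ) ⊗ preimageᵗ ⊗ v₀)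

      back : ∀ b b′ → lam backᵗ ∈ ((b B.∼ b′) ⇒ (G ∘R flip G) b b′)
      back b b′ = lam-⇒ (b B.∼ b′) ((G ∘R flip G) b b′) backᵗ λ W w →
        let a , g = surjective b _ (ls b b′ W w)
        in a , ∧-intro (G a b) (G a b′) g
                 (relational a a b b′ _ (∧₃-intro (a A.∼ a) (G a b) (b B.∼ b′) (proj₁ (strict a b _ g)) g w))

    bijective⇒Iso : ⊩ LeftStrict A → ⊩ LeftStrict B → Iso A B
    bijective⇒Iso A-leftStrict B-leftStrict =
      G , flip G , G-funRel , converse-isFunRel , converse-inverseˡ A-leftStrict , converse-inverseʳ B-leftStrict

  -- The exponential of an assembly

  tripleᵗ : Term n → Term n → Term n → Term n
  tripleᵗ p q r = cst (num 3) ⊗ p ⊗ q ⊗ r ⊗ cst ∅ₛ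

  Pᵗ Qᵗ Rᵗ : Term n → Term n
  Pᵗ = fst ∘ snd
  Qᵗ = fst ∘ snd ∘ snd
  Rᵗ = fst ∘ snd ∘ snd ∘ snd

  module _ {a e c ℓ} (Y : PreObj c ℓ) (Y-isObject : IsObject Y) (X : Set a) (E : X → PS e) where
    open PreObj Y

    private
      r : Level
      r = lsuc lzero ⊔ a ⊔ e ⊔ c ⊔ ℓ

      Xₐ : PreObj a (a ⊔ e)
      Xₐ = Asm X E

      _∼ₓ_ : X → X → PS (a ⊔ e)
      _∼ₓ_ = PreObj._∼_ Xₐ

      Yˣ : PreObj (lsuc r) r
      Yˣ = Exp {r = r} Xₐ Y

      Fₒ : PreObj (lsuc lzero ⊔ a ⊔ e ⊔ c) (lsuc lzero ⊔ a ⊔ e ⊔ ℓ)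
      Fₒ = Fobj Y X E

    Rel : Set (lsuc r)
    Rel = X → Car → PS r

    _≃_ : Rel → Rel → PS r
    _≃_ = PreObj._∼_ Yˣ

    Fun : Set (lsuc lzero ⊔ a ⊔ e ⊔ c)
    Fun = F Y X E

    _≈ᶠ_ : Fun → Fun → PS (lsuc lzero ⊔ a ⊔ e ⊔ ℓ)
    _≈ᶠ_ = _≈_ Y X E

    symᵣ transᵣ : 𝕊
    symᵣ   = proj₁ (proj₁ Y-isObject)
    transᵣ = proj₁ (proj₂ Y-isObject)

    ∼-sym : ∀ {y y′ U} → U ∈ (y ∼ y′) → symᵣ · U ∈ (y′ ∼ y)
    ∼-sym = proj₂ (proj₁ Y-isObject) _ _ _

    ∼-trans : ∀ {y y′ y″ U V} → U ∈ (y ∼ y′) → V ∈ (y′ ∼ y″) → transᵣ · (U ⊕ V) ∈ (y ∼ y″)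
    ∼-trans {y} {y′} {y″} u v = proj₂ (proj₂ Y-isObject) y y′ y″ _ (∧-intro (y ∼ y′) (y′ ∼ y″) u v)

    ≈ᶠ-unpack : ∀ f g {W} → W ∈ (f ≈ᶠ g) → ≈-cond Y X E f g (Pᵣ W) (Qᵣ W) (Rᵣ W)
    ≈ᶠ-unpack f g (P , Q , R , w , P∈ , Q∈ , R∈) =
      (λ x U u → PS.resp (f (x , U , u) ∼ f (x , U , u)) (·-respˡ (≐-sym (Pᵣ-triple w))) (P∈ x U u)) ,
      (λ x U U′ u u′ → PS.resp (f (x , U , u) ∼ f (x , U′ , u′)) (·-respˡ (·-respˡ (≐-sym (Qᵣ-triple w))))
                               (Q∈ x U U′ u u′)) ,
      (λ x U u → PS.resp (f (x , U , u) ∼ g (x , U , u)) (·-respˡ (≐-sym (Rᵣ-triple w))) (R∈ x U u))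

    ≈ᶠ-pack : ∀ {f g P Q R} → ≈-cond Y X E f g P Q R → triple P Q R ∈ (f ≈ᶠ g)
    ≈ᶠ-pack h = _ , _ , _ , ≐-refl , h

    funRelˡᵗ funRelʳᵗ forthᵗ : Term n → Term n
    funRelˡᵗ = fst ∘ fst
    funRelʳᵗ = snd ∘ fst
    forthᵗ   = fst ∘ snd

    ≃-intro : ∀ R R′ {V V′ T} → V ∈ FunRel Xₐ Y R → V′ ∈ FunRel Xₐ Y R′ → T ∈ RelEquiv R R′ →
      (V ⊕ V′) ⊕ T ∈ (R ≃ R′)
    ≃-intro R R′ v v′ =
      ∧-intro (FunRel Xₐ Y R ∧ FunRel Xₐ Y R′) (RelEquiv R R′) (∧-intro (FunRel Xₐ Y R) (FunRel Xₐ Y R′) v v′)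

    ≃-reflᵗ : Term n → Term n
    ≃-reflᵗ t = (t ⊗ t) ⊗ cst idᵣ ⊗ cst idᵣ

    ≃-refl : ∀ R (t : Term n) ρ → ⟦ t ⟧ ρ ∈ FunRel Xₐ Y R → ⟦ ≃-reflᵗ t ⟧ ρ ∈ (R ≃ R)
    ≃-refl R t ρ v = ≃-intro R R v v (relEquiv-refl R)

    Tracks : Rel → Fun → PS r
    Tracks R f = mkPS (λ T → ∀ x U (u : U ∈ E x) → T · U ∈ R x (f (x , U , u)))
                      (λ p h x U u → PS.resp (R x _) (·-respˡ p) (h x U u))

    TrackedFunRel : Rel → Fun → PS r
    TrackedFunRel R f = FunRel Xₐ Y R ∧ Tracks R f

    Choice : Rel → Fun → PS (lsuc r)
    Choice R f = ↑ (lsuc r) ((R ≃ R) ∧ Tracks R f)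

    trackedFunRelᵗ : Term n → Term n
    trackedFunRelᵗ g = funRelˡᵗ (fst g) ⊗ snd g

    choice⇒trackedFunRel : ∀ R f (g : Term n) ρ → ⟦ g ⟧ ρ ∈ Choice R f → ⟦ trackedFunRelᵗ g ⟧ ρ ∈ TrackedFunRel R f
    choice⇒trackedFunRel R f g ρ (lift (e , t)) = ∧-intro (FunRel Xₐ Y R) (Tracks R f) (proj₁ (proj₁ e)) t

    private
      reflAtᵗ : Term 2
      reflAtᵗ = snd (strictᵗ (fst v₁) ∙ (snd v₁ ∙ v₀))

      eqAtᵗ : Term 3
      eqAtᵗ = singleValuedᵗ (fst v₂) ∙ ((snd v₂ ∙ v₁) ⊗ (snd v₂ ∙ v₀))

    tracked-≈ᶠ-reflᵗ : Term 1
    tracked-≈ᶠ-reflᵗ = tripleᵗ (ƛ reflAtᵗ) (ƛ ƛ eqAtᵗ) (ƛ reflAtᵗ)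

    tracked-≈ᶠ-refl : ∀ R f → lam tracked-≈ᶠ-reflᵗ ∈ (TrackedFunRel R f ⇒ (f ≈ᶠ f))
    tracked-≈ᶠ-refl R f = lam-⇒ (TrackedFunRel R f) (f ≈ᶠ f) tracked-≈ᶠ-reflᵗ λ Z (v , t) →
      let open FunRelRealizer Xₐ Y R (π₁ Z) v
          refl∈ : ∀ x U (u : U ∈ E x) → ⟦ ƛ reflAtᵗ ⟧ (Z ∷ₑ ε) · U ∈ (f (x , U , u) ∼ f (x , U , u))
          refl∈ x U u = β-∈ (f (x , U , u) ∼ f (x , U , u)) reflAtᵗ (Z ∷ₑ ε) (proj₂ (strict x _ _ (t x U u)))
      in ≈ᶠ-pack (refl∈ , (λ x U U′ u u′ → β₂-∈ (f (x , U , u) ∼ f (x , U′ , u′)) eqAtᵗ (Z ∷ₑ ε)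
                    (singleValued x _ _ _ (∧-intro (R x _) (R x _) (t x U u) (t x U′ u′)))) ,
                  refl∈)

    choice-strictᵗ : Term 1
    choice-strictᵗ = fst v₀ ⊗ cst (lam tracked-≈ᶠ-reflᵗ) ∙ trackedFunRelᵗ v₀

    choice-strict : ⊩ Strict Yˣ Fₒ Choice
    choice-strict = lam choice-strictᵗ , lift λ R f →
      lam-⇒ (Choice R f) ((R ≃ R) ∧ (f ≈ᶠ f)) choice-strictᵗ λ W g →
        ∧-intro (R ≃ R) (f ≈ᶠ f) (proj₁ (lower g)) (tracked-≈ᶠ-refl R f _ (choice⇒trackedFunRel R f v₀ (W ∷ₑ ε) g))

    private
      transportᵗ : Term 2
      transportᵗ = relationalᵗ (funRelʳᵗ (fst v₁)) ∙
        (v₀ ⊗ (forthᵗ (fst v₁) ∙ (snd (fst (snd v₁)) ∙ v₀)) ⊗ (Rᵗ (snd (snd v₁)) ∙ v₀))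

    transport-tracks : ∀ R R′ f f′ W → W ∈ ((R ≃ R′) ∧ Choice R f ∧ (f ≈ᶠ f′)) →
      ⟦ ƛ transportᵗ ⟧ (W ∷ₑ ε) ∈ Tracks R′ f′
    transport-tracks R R′ f f′ W (e , lift (_ , t) , q) x U u =
      β-∈ (R′ x f′ᵤ) transportᵗ (W ∷ₑ ε)
        (relational x x fᵤ f′ᵤ _ (∧₃-intro (x ∼ₓ x) (R′ x fᵤ) (fᵤ ∼ f′ᵤ) (refl , u)
          (proj₁ (proj₂ e x fᵤ) _ (t x U u)) (proj₂ (proj₂ (≈ᶠ-unpack f f′ q)) x U u)))
      where
      open FunRelRealizer Xₐ Y R′ (π₂ (π₁ (π₁ W))) (proj₂ (proj₁ e))
      fᵤ f′ᵤ : Car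
      fᵤ  = f  (x , U , u)
      f′ᵤ = f′ (x , U , u)

    choice-relationalᵗ : Term 1
    choice-relationalᵗ = ≃-reflᵗ (funRelʳᵗ (fst v₀)) ⊗ (ƛ transportᵗ)

    choice-relational : ⊩ Relational Yˣ Fₒ Choice
    choice-relational = lam choice-relationalᵗ , lift λ R R′ f f′ →
      lam-⇒ ((R ≃ R′) ∧ Choice R f ∧ (f ≈ᶠ f′)) (Choice R′ f′) choice-relationalᵗ λ W w →
        lift (∧-intro (R′ ≃ R′) (Tracks R′ f′) (≃-refl R′ (funRelʳᵗ (fst v₀)) (W ∷ₑ ε) (proj₂ (proj₁ (proj₁ w))))
                (transport-tracks R R′ f f′ W w))

    private
      compareᵗ : Term 2
      compareᵗ = singleValuedᵗ (funRelˡᵗ (fst (fst v₁))) ∙ ((snd (fst v₁) ∙ v₀) ⊗ (snd (snd v₁) ∙ v₀))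

    choice-singleValuedᵗ : Term 1
    choice-singleValuedᵗ = tripleᵗ (Pᵗ f≈fᵗ) (Qᵗ f≈fᵗ) (ƛ compareᵗ)
      where
      f≈fᵗ : Term 1
      f≈fᵗ = cst (lam tracked-≈ᶠ-reflᵗ) ∙ trackedFunRelᵗ (fst v₀)

    choice-singleValued : ⊩ SingleValued Yˣ Fₒ Choice
    choice-singleValued = lam choice-singleValuedᵗ , lift λ R f f′ →
      lam-⇒ (Choice R f ∧ Choice R f′) (f ≈ᶠ f′) choice-singleValuedᵗ λ W (g , g′) →
        let P∈ , Q∈ , _ = ≈ᶠ-unpack f f (tracked-≈ᶠ-refl R f _ (choice⇒trackedFunRel R f (fst v₀) (W ∷ₑ ε) g))
            open FunRelRealizer Xₐ Y R (π₁ (π₁ (π₁ (π₁ W)))) (proj₁ (proj₁ (proj₁ (lower g))))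
        in ≈ᶠ-pack (P∈ , Q∈ , λ x U u →
             β-∈ (f (x , U , u) ∼ f′ (x , U , u)) compareᵗ (W ∷ₑ ε)
               (singleValued x _ _ _ (∧-intro (R x _) (R x _) (proj₂ (lower g) x U u) (proj₂ (lower g′) x U u))))

    choice-totalᵗ : Term 1
    choice-totalᵗ = v₀ ⊗ totalᵗ (funRelˡᵗ v₀)

    choice-total : ⊩ Total Yˣ Fₒ Choice
    choice-total = lam choice-totalᵗ , lift λ R →
      lam-⇒ (R ≃ R) (⋁ Fun λ f → Choice R f) choice-totalᵗ λ W e →
        let open FunRelRealizer Xₐ Y R (π₁ (π₁ W)) (proj₁ (proj₁ e))
            f : Fun
            f (x , U , u) = proj₁ (total x U (refl , u))
        in f , lift (∧-intro (R ≃ R) (Tracks R f) e λ x U u → proj₂ (total x U (refl , u)))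

    choice-isFunRel : IsFunRel Yˣ Fₒ Choice
    choice-isFunRel =
      proj₁ choice-strict ⊕ (proj₁ choice-relational ⊕ (proj₁ choice-singleValued ⊕ proj₁ choice-total)) ,
      funRel-intro Yˣ Fₒ Choice
        (proj₂ choice-strict) (proj₂ choice-relational) (proj₂ choice-singleValued) (proj₂ choice-total)

    private
      -- With V ∈ R x y: strictness of R gives U ∈ E x, single-valuedness of R gives y ∼ f(x, U),
      -- and relationality of R′ moves the R′-tracker of f at U to R′ x y.
      transferᵗ : Term 2
      transferᵗ = relationalᵗ fr′ ∙ (Uᵗ ⊗ (t′ ∙ Uᵗ) ⊗ cst symᵣ ∙ (singleValuedᵗ fr ∙ (v₀ ⊗ t ∙ Uᵗ)))
        where
        fr t fr′ t′ Uᵗ : Term 2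
        fr  = fst (fst v₁)
        t   = snd (fst v₁)
        fr′ = fst (snd v₁)
        t′  = snd (snd v₁)
        Uᵗ  = fst (strictᵗ fr ∙ v₀)

    tracked-⊆ : ∀ R R′ f → lam (ƛ transferᵗ) ∈
      ((TrackedFunRel R f ∧ TrackedFunRel R′ f) ⇒ (⋀ X λ x → ⋀ Car λ y → R x y ⇒ R′ x y))
    tracked-⊆ R R′ f =
      lam-⇒ (TrackedFunRel R f ∧ TrackedFunRel R′ f) (⋀ X λ x → ⋀ Car λ y → R x y ⇒ R′ x y) (ƛ transferᵗ)
        λ Z ((v , t) , (v′ , t′)) x y V w →
          let module R  = FunRelRealizer Xₐ Y R  (π₁ (π₁ Z)) v
              module R′ = FunRelRealizer Xₐ Y R′ (π₁ (π₂ Z)) v′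
              U = π₁ (R.strictᵣ · V)
              u : U ∈ E x
              u = proj₂ (proj₁ (R.strict x y V w))
              fU = f (x , U , u)
          in β-∈ (R′ x y) transferᵗ (Z ∷ₑ ε)
               (R′.relational x x fU y _ (∧₃-intro (x ∼ₓ x) (R′ x fU) (fU ∼ y) (refl , u) (t′ x U u)
                 (∼-sym (R.singleValued x y fU _ (∧-intro (R x y) (R x fU) w (t x U u))))))

    choice-injectiveᵗ : Term 1
    choice-injectiveᵗ = (fst (trackedFunRelᵗ (fst v₀)) ⊗ fst (trackedFunRelᵗ (snd v₀))) ⊗
      cst (lam (ƛ transferᵗ)) ∙ (trackedFunRelᵗ (fst v₀) ⊗ trackedFunRelᵗ (snd v₀)) ⊗
      cst (lam (ƛ transferᵗ)) ∙ (trackedFunRelᵗ (snd v₀) ⊗ trackedFunRelᵗ (fst v₀))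

    choice-injective : ⊩ SingleValued Fₒ Yˣ (flip Choice)
    choice-injective = lam choice-injectiveᵗ , lift λ f R R′ →
      lam-⇒ (Choice R f ∧ Choice R′ f) (R ≃ R′) choice-injectiveᵗ λ W (g , g′) →
        let d  = choice⇒trackedFunRel R  f (fst v₀) (W ∷ₑ ε) g
            d′ = choice⇒trackedFunRel R′ f (snd v₀) (W ∷ₑ ε) g′
        in ≃-intro R R′ (proj₁ d) (proj₁ d′) (relEquiv-intro {R = R} {R′}
             (tracked-⊆ R R′ f _ (∧-intro (TrackedFunRel R f) (TrackedFunRel R′ f) d d′))
             (tracked-⊆ R′ R f _ (∧-intro (TrackedFunRel R′ f) (TrackedFunRel R f) d′ d)))

    graphOf : Fun → Rel
    graphOf f x y = ↑ r (mkPS (λ V → π₁ V ∈ E x × (∀ U (u : U ∈ E x) → π₂ V · U ∈ (f (x , U , u) ∼ y)))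
                              (λ p (U₀∈ , H∈) → PS.resp (E x) (π₁-cong p) U₀∈ ,
                                                λ U u → PS.resp (f (x , U , u) ∼ y) (·-respˡ (π₂-cong p)) (H∈ U u)))

    graphOf-intro : ∀ f x y {U₀ H} → U₀ ∈ E x → (∀ U (u : U ∈ E x) → H · U ∈ (f (x , U , u) ∼ y)) →
      U₀ ⊕ H ∈ graphOf f x y
    graphOf-intro f x y {U₀} {H} U₀∈ H∈ = lift (PS.resp (E x) (≐-sym (π₁-⊕ U₀ H)) U₀∈ ,
      λ U u → PS.resp (f (x , U , u) ∼ y) (·-respˡ (≐-sym (π₂-⊕ U₀ H))) (H∈ U u))

    private
      atᵗ : Term 1
      atᵗ = snd v₀ ∙ fst v₀

      continueᵗ : Term 2
      continueᵗ = cst transᵣ ∙ ((snd (fst (snd v₁)) ∙ v₀) ⊗ snd (snd v₁))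

      graph-strictᵗ graph-relationalᵗ graph-singleValuedᵗ : Term 1
      graph-strictᵗ       = fst v₀ ⊗ cst transᵣ ∙ ((cst symᵣ ∙ atᵗ) ⊗ atᵗ)
      graph-relationalᵗ   = fst (fst (snd v₀)) ⊗ (ƛ continueᵗ)
      graph-singleValuedᵗ = cst transᵣ ∙ ((cst symᵣ ∙ (snd (fst v₀) ∙ fst (fst v₀))) ⊗ (snd (snd v₀) ∙ fst (fst v₀)))

    graphOf-strict : ∀ f → lam graph-strictᵗ ∈ Strict Xₐ Y (graphOf f)
    graphOf-strict f = lift λ x y →
      lam-⇒ (graphOf f x y) ((x ∼ₓ x) ∧ (y ∼ y)) graph-strictᵗ λ V (lift (U₀∈ , H∈)) →
        ∧-intro (x ∼ₓ x) (y ∼ y) (refl , U₀∈) (∼-trans (∼-sym (H∈ _ U₀∈)) (H∈ _ U₀∈))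

    graphOf-relational : ∀ f → lam graph-relationalᵗ ∈ Relational Xₐ Y (graphOf f)
    graphOf-relational f = lift λ x x′ y y′ →
      lam-⇒ ((x ∼ₓ x′) ∧ graphOf f x y ∧ (y ∼ y′)) (graphOf f x′ y′) graph-relationalᵗ
        λ { W ((refl , _) , lift (U₀∈ , H∈) , y∼y′) → graphOf-intro f x y′ U₀∈ λ U u →
              β-∈ (f (x , U , u) ∼ y′) continueᵗ (W ∷ₑ ε) (∼-trans (H∈ U u) y∼y′) }

    graphOf-singleValued : ∀ f → lam graph-singleValuedᵗ ∈ SingleValued Xₐ Y (graphOf f)
    graphOf-singleValued f = lift λ x y y′ →
      lam-⇒ (graphOf f x y ∧ graphOf f x y′) (y ∼ y′) graph-singleValuedᵗ
        λ W (lift (U₀∈ , H∈) , lift (_ , H′∈)) → ∼-trans (∼-sym (H∈ _ U₀∈)) (H′∈ _ U₀∈)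

    private
      valueᵗ : Term 1
      valueᵗ = ƛ v₀ ⊗ (ƛ Qᵗ v₂ ∙ v₀ ∙ v₁)

    value-tracks : ∀ f W → W ∈ (f ≈ᶠ f) → ⟦ valueᵗ ⟧ (W ∷ₑ ε) ∈ Tracks (graphOf f) f
    value-tracks f W w x U u =
      β-∈ (graphOf f x (f (x , U , u))) (v₀ ⊗ (ƛ Qᵗ v₂ ∙ v₀ ∙ v₁)) (W ∷ₑ ε)
        (graphOf-intro f x _ u λ U′ u′ →
          β-∈ (f (x , U′ , u′) ∼ f (x , U , u)) (Qᵗ v₂ ∙ v₀ ∙ v₁) (U ∷ₑ W ∷ₑ ε)
            (proj₁ (proj₂ (≈ᶠ-unpack f f w)) x U′ U u′ u))

    graph-funRelᵗ : Term 1
    graph-funRelᵗ = cst (lam graph-strictᵗ) ⊗ cst (lam graph-relationalᵗ) ⊗ cst (lam graph-singleValuedᵗ) ⊗ valueᵗ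

    graphOf-isFunRel : ∀ f W → W ∈ (f ≈ᶠ f) → ⟦ graph-funRelᵗ ⟧ (W ∷ₑ ε) ∈ FunRel Xₐ Y (graphOf f)
    graphOf-isFunRel f W w =
      funRel-intro Xₐ Y (graphOf f) (graphOf-strict f) (graphOf-relational f) (graphOf-singleValued f)
        (lift λ x U (_ , u) → f (x , U , u) , value-tracks f W w x U u)

    choice-surjectiveᵗ : Term 1
    choice-surjectiveᵗ = ≃-reflᵗ graph-funRelᵗ ⊗ valueᵗ

    choice-surjective : ⊩ Total Fₒ Yˣ (flip Choice)
    choice-surjective = lam choice-surjectiveᵗ , lift λ f →
      lam-⇒ (f ≈ᶠ f) (⋁ Rel λ R → Choice R f) choice-surjectiveᵗ λ W w →
        graphOf f , lift (∧-intro (graphOf f ≃ graphOf f) (Tracks (graphOf f) f)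
                       (≃-refl (graphOf f) graph-funRelᵗ (W ∷ₑ ε) (graphOf-isFunRel f W w)) (value-tracks f W w))

    ≃-leftStrict : ⊩ LeftStrict Yˣ
    ≃-leftStrict = lam (≃-reflᵗ (funRelˡᵗ v₀)) , λ R R′ →
      lam-⇒ (R ≃ R′) (R ≃ R) (≃-reflᵗ (funRelˡᵗ v₀)) λ W e → ≃-refl R (funRelˡᵗ v₀) (W ∷ₑ ε) (proj₁ (proj₁ e))

    ≈ᶠ-leftStrict : ⊩ LeftStrict Fₒ
    ≈ᶠ-leftStrict = lam (tripleᵗ (Pᵗ v₀) (Qᵗ v₀) (Pᵗ v₀)) , λ f g →
      lam-⇒ (f ≈ᶠ g) (f ≈ᶠ f) (tripleᵗ (Pᵗ v₀) (Qᵗ v₀) (Pᵗ v₀)) λ W w →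
        let P∈ , Q∈ , _ = ≈ᶠ-unpack f g w in ≈ᶠ-pack (P∈ , Q∈ , P∈)

    exponential≅F : Iso Yˣ Fₒ
    exponential≅F = bijective⇒Iso {A = Yˣ} {B = Fₒ} {G = Choice}
      choice-isFunRel choice-injective choice-surjective ≃-leftStrict ≈ᶠ-leftStrict

proposition2p3 : (π : (ℕ × ℕ) ⤖ ℕ) →
    let open Model (λ m n → Bijection.to π (m , n)) in
    ∀ {a e c ℓ : Level} (Y : PreObj c ℓ) → IsObject Y →
    (X : Set a) (E : X → PS e) → IsAssembly X E →
    Iso (Exp {r = lsuc lzero ⊔ a ⊔ e ⊔ c ⊔ ℓ} (Asm X E) Y) (Fobj Y X E)
proposition2p3 π Y Y-isObject X E _ =
  exponential≅F (λ m n → Bijection.to π (m , n)) pairing-injective Y Y-isObject X E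
  where
  pairing-injective : ∀ {m k m′ k′} → Bijection.to π (m , k) ≡ Bijection.to π (m′ , k′) → m ≡ m′ × k ≡ k′
  pairing-injective eq = cong proj₁ (Bijection.injective π eq) , cong proj₂ (Bijection.injective π eq)
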